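{- Let $d_1,\dots,d_k\in\{1,\dots,5\}$ and let $Y_1,\dots,Y_6$ be as described in the context. Then $3\,\mathrm{Ht}(Y_1)\le\mathrm{Ht}(Y_2)$ and $3\,\mathrm{Ht}(Y_6)\le\mathrm{Ht}(Y_5)$.
   Context: Let $M_1=\begin{pmatrix}-3&1&4\\-4&-1&4\\-6&0&7\end{pmatrix}$, $M_2=\begin{pmatrix}4&1&4\\3&-1&4\\6&0&7\end{pmatrix}$, $M_3=\begin{pmatrix}4&3&4\\3&4&4\\6&6&7\end{pmatrix}$, $M_4=\begin{pmatrix}-1&3&4\\1&4&4\\0&6&7\end{pmatrix}$, $M_5=\begin{pmatrix}-1&-4&4\\1&-3&4\\0&-6&7\end{pmatrix}$. Let $\mathbf{u}_1=(1,0,1)$, $\mathbf{u}_2=(5,3,7)$, $\mathbf{u}_3=(8,7,13)$, $\mathbf{u}_4=(7,8,13)$, $\mathbf{u}_5=(3,5,7)$, $\mathbf{u}_6=(0,1,1)$ (column vectors), $\mathbf{y}_j=M_{d_1}\cdots M_{d_k}\mathbf{u}_j$, and $Y_j$ the point $(y_{j,1}/y_{j,3},y_{j,2}/y_{j,3})$ represented by $\mathbf{y}_j=(y_{j,1},y_{j,2},y_{j,3})$; these are rational points on $\{x^2+xy+y^2=1,\ x,y\ge0\}$. For such a rational point $Z=(a/c,b/c)$ with $a,b,c$ coprime nonnegative integers and $c>0$, $\mathrm{Ht}(Z)=c$. -}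

module Defs where

open import Data.Nat using (ℕ; _/_; _≡ᵇ_)
open import Data.Nat.GCD using (gcd)
open import Data.Integer using (ℤ; +_; -[1+_]; _+_; _*_; ∣_∣)
open import Data.Fin using (Fin; zero; suc)
open import Data.List using (List; []; _∷_)
open import Data.Product using (_×_; _,_)
open import Data.Bool using (if_then_else_)

V3 : Set
V3 = ℤ × ℤ × ℤ

-- 3x3 integer matrices, given by their three rows
M3 : Set
M3 = V3 × V3 × V3

dot : V3 → V3 → ℤ
dot (a , b , c) (x , y , z) = a * x + b * y + c * z

_·_ : M3 → V3 → V3
(r₁ , r₂ , r₃) · v = dot r₁ v , dot r₂ v , dot r₃ v

infixr 20 _·_

n1 n3 n4 n6 : ℤ
n1 = -[1+ 0 ]
n3 = -[1+ 2 ]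
n4 = -[1+ 3 ]
n6 = -[1+ 5 ]

-- the matrices M_1,...,M_5; digit d ∈ {1,..,5} is represented by Fin 5 (zero ↦ 1, ..., 4 ↦ 5)
M : Fin 5 → M3
M zero = (n3 , + 1 , + 4) , (n4 , n1 , + 4) , (n6 , + 0 , + 7)
M (suc zero) = (+ 4 , + 1 , + 4) , (+ 3 , n1 , + 4) , (+ 6 , + 0 , + 7)
M (suc (suc zero)) = (+ 4 , + 3 , + 4) , (+ 3 , + 4 , + 4) , (+ 6 , + 6 , + 7)
M (suc (suc (suc zero))) = (n1 , + 3 , + 4) , (+ 1 , + 4 , + 4) , (+ 0 , + 6 , + 7)
M (suc (suc (suc (suc zero)))) = (n1 , n4 , + 4) , (+ 1 , n3 , + 4) , (+ 0 , n6 , + 7)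

applyWord : List (Fin 5) → V3 → V3
applyWord [] v = v
applyWord (d ∷ ds) v = M d · applyWord ds v

u₁ u₂ u₃ u₄ u₅ u₆ : V3
u₁ = + 1 , + 0 , + 1
u₂ = + 5 , + 3 , + 7
u₃ = + 8 , + 7 , + 13
u₄ = + 7 , + 8 , + 13
u₅ = + 3 , + 5 , + 7
u₆ = + 0 , + 1 , + 1

y : List (Fin 5) → V3 → V3
y ds u = applyWord ds u

-- Height of the rational point (y₁/y₃, y₂/y₃) represented by (y₁,y₂,y₃):
-- writing the point as (a/c, b/c) with a,b,c coprime, nonnegative, c > 0, Ht = c.
-- Concretely c = |y₃| / gcd(|y₁|,|y₂|,|y₃|)  (the representing vector is a
-- rational multiple of (a,b,c)).  The gcd is nonzero since y₃ ≠ 0 for these points;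
-- the degenerate branch (gcd = 0) is never reached and returns 0.
Ht : V3 → ℕ
Ht (a , b , c) with gcd (gcd ∣ a ∣ ∣ b ∣) ∣ c ∣
... | ℕ.zero = 0
... | ℕ.suc g = ∣ c ∣ / ℕ.suc g

module Submission where

-- Put W = M_{d_1} ⋯ M_{d_k}.  The height of the point represented
-- by an integer vector v is at most |v₃|, with equality when v is primitive
-- (its coordinates have no common divisor).  Two invariants of the matrices M_d
-- carry the argument:
--   * each M_d has an integer inverse, so W maps primitive vectors to primitive
--     vectors; u₂ and u₅ are primitive, hence Ht(W u₂) = |(W u₂)₃|, and likewise
--     for u₅;
--   * each M_d maps the cone C spanned over ℕ by (1,0,1), (0,1,1), (3,2,4),
--     (2,3,4) into itself, so W preserves C, and vectors of C have third
--     coordinate ≥ 0.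
-- Since u₂ = 3 u₁ + (2,3,4) and u₅ = 3 u₆ + (3,2,4) with all summands in C,
-- linearity gives (W u₂)₃ = 3 (W u₁)₃ + c with c ≥ 0, whence
-- 3 Ht(W u₁) ≤ 3 |(W u₁)₃| ≤ |(W u₂)₃| = Ht(W u₂); the same for u₆, u₅.

open import Defs
open import Data.Nat using (ℕ; _≤_; _*_; _+_; z≤n)
open import Data.Nat.Properties using (≤-trans; ≤-reflexive; *-monoʳ-≤; m≤m+n; module ≤-Reasoning)
open import Data.Nat.Divisibility using (∣1⇒≡1; ∣-trans) renaming (_∣_ to _∣ℕ_)
open import Data.Nat.DivMod using (n/1≡n; m/n≤m)
open import Data.Nat.GCD using (gcd; gcd[m,n]∣m; gcd[m,n]∣n)
open import Data.Integer using (ℤ; +_; -_; ∣_∣) renaming (_+_ to _+ℤ_; _*_ to _*ℤ_)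
open import Data.Integer.Properties using (pos-+; pos-*)
open import Data.Integer.Divisibility.Signed using (_∣_; ∣ᵤ⇒∣; ∣⇒∣ᵤ; ∣m∣n⇒∣m+n; ∣n⇒∣m*n; ∣m∣n⇒∣m-n)
open import Data.Integer.Tactic.RingSolver using (solve-∀)
open import Data.Fin using (Fin; zero; suc)
open import Data.List using (List; []; _∷_)
open import Data.Product using (_×_; _,_; Σ)
open import Relation.Binary.PropositionalEquality using (_≡_; refl; sym; trans; cong; cong₂; subst; module ≡-Reasoning)

_⊕_ : V3 → V3 → V3
(a , b , c) ⊕ (x , y , z) = a +ℤ x , b +ℤ y , c +ℤ z

infixl 5 _⊕_

_⊙_ : ℤ → V3 → V3
k ⊙ (x , y , z) = k *ℤ x , k *ℤ y , k *ℤ z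

infixr 6 _⊙_

third : V3 → ℤ
third (_ , _ , c) = c

triple-cong : ∀ {a b c a′ b′ c′ : ℤ} → a ≡ a′ → b ≡ b′ → c ≡ c′ → (a , b , c) ≡ (a′ , b′ , c′)
triple-cong refl refl refl = refl

dot-additive : ∀ r u v → dot r (u ⊕ v) ≡ dot r u +ℤ dot r v
dot-additive (a , b , c) (x , y , z) (x′ , y′ , z′) = identity a b c x y z x′ y′ z′
  where
  identity : ∀ a b c x y z x′ y′ z′ →
    a *ℤ (x +ℤ x′) +ℤ b *ℤ (y +ℤ y′) +ℤ c *ℤ (z +ℤ z′)
      ≡ (a *ℤ x +ℤ b *ℤ y +ℤ c *ℤ z) +ℤ (a *ℤ x′ +ℤ b *ℤ y′ +ℤ c *ℤ z′)
  identity = solve-∀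

dot-homogeneous : ∀ r k v → dot r (k ⊙ v) ≡ k *ℤ dot r v
dot-homogeneous (a , b , c) k (x , y , z) = identity a b c k x y z
  where
  identity : ∀ a b c k x y z →
    a *ℤ (k *ℤ x) +ℤ b *ℤ (k *ℤ y) +ℤ c *ℤ (k *ℤ z) ≡ k *ℤ (a *ℤ x +ℤ b *ℤ y +ℤ c *ℤ z)
  identity = solve-∀

·-additive : ∀ m u v → m · (u ⊕ v) ≡ m · u ⊕ m · v
·-additive (r₁ , r₂ , r₃) u v = triple-cong (dot-additive r₁ u v) (dot-additive r₂ u v) (dot-additive r₃ u v)

·-homogeneous : ∀ m k v → m · (k ⊙ v) ≡ k ⊙ m · v
·-homogeneous (r₁ , r₂ , r₃) k v =
  triple-cong (dot-homogeneous r₁ k v) (dot-homogeneous r₂ k v) (dot-homogeneous r₃ k v)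

word-additive : ∀ ds u v → applyWord ds (u ⊕ v) ≡ applyWord ds u ⊕ applyWord ds v
word-additive [] u v = refl
word-additive (d ∷ ds) u v =
  trans (cong (M d ·_) (word-additive ds u v)) (·-additive (M d) (applyWord ds u) (applyWord ds v))

word-homogeneous : ∀ ds k v → applyWord ds (k ⊙ v) ≡ k ⊙ applyWord ds v
word-homogeneous [] k v = refl
word-homogeneous (d ∷ ds) k v =
  trans (cong (M d ·_) (word-homogeneous ds k v)) (·-homogeneous (M d) k (applyWord ds v))

_ᵀ·_ : V3 → M3 → V3
(a , b , c) ᵀ· ((p₁ , p₂ , p₃) , (q₁ , q₂ , q₃) , (s₁ , s₂ , s₃)) =
  a *ℤ p₁ +ℤ b *ℤ q₁ +ℤ c *ℤ s₁ , a *ℤ p₂ +ℤ b *ℤ q₂ +ℤ c *ℤ s₂ , a *ℤ p₃ +ℤ b *ℤ q₃ +ℤ c *ℤ s₃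

_⊗_ : M3 → M3 → M3
(r₁ , r₂ , r₃) ⊗ m = r₁ ᵀ· m , r₂ ᵀ· m , r₃ ᵀ· m

I₃ : M3
I₃ = (+ 1 , + 0 , + 0) , (+ 0 , + 1 , + 0) , (+ 0 , + 0 , + 1)

dot-assoc : ∀ r m v → dot r (m · v) ≡ dot (r ᵀ· m) v
dot-assoc (a , b , c) ((p₁ , p₂ , p₃) , (q₁ , q₂ , q₃) , (s₁ , s₂ , s₃)) (x , y , z) =
  identity a b c p₁ p₂ p₃ q₁ q₂ q₃ s₁ s₂ s₃ x y z
  where
  identity : ∀ a b c p₁ p₂ p₃ q₁ q₂ q₃ s₁ s₂ s₃ x y z →
    a *ℤ (p₁ *ℤ x +ℤ p₂ *ℤ y +ℤ p₃ *ℤ z) +ℤ b *ℤ (q₁ *ℤ x +ℤ q₂ *ℤ y +ℤ q₃ *ℤ z)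
      +ℤ c *ℤ (s₁ *ℤ x +ℤ s₂ *ℤ y +ℤ s₃ *ℤ z)
    ≡ (a *ℤ p₁ +ℤ b *ℤ q₁ +ℤ c *ℤ s₁) *ℤ x +ℤ (a *ℤ p₂ +ℤ b *ℤ q₂ +ℤ c *ℤ s₂) *ℤ y
      +ℤ (a *ℤ p₃ +ℤ b *ℤ q₃ +ℤ c *ℤ s₃) *ℤ z
  identity = solve-∀

·-assoc : ∀ n m v → n · (m · v) ≡ (n ⊗ m) · v
·-assoc (r₁ , r₂ , r₃) m v = triple-cong (dot-assoc r₁ m v) (dot-assoc r₂ m v) (dot-assoc r₃ m v)

·-identity : ∀ v → I₃ · v ≡ v
·-identity (x , y , z) = triple-cong (first x y z) (second x y z) (last x y z)
  where
  first : ∀ x y z → + 1 *ℤ x +ℤ + 0 *ℤ y +ℤ + 0 *ℤ z ≡ x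
  first = solve-∀
  second : ∀ x y z → + 0 *ℤ x +ℤ + 1 *ℤ y +ℤ + 0 *ℤ z ≡ y
  second = solve-∀
  last : ∀ x y z → + 0 *ℤ x +ℤ + 0 *ℤ y +ℤ + 1 *ℤ z ≡ z
  last = solve-∀

M⁻¹ : Fin 5 → M3
M⁻¹ zero = (- + 7 , - + 7 , + 8) , (+ 4 , + 3 , - + 4) , (- + 6 , - + 6 , + 7)
M⁻¹ (suc zero) = (+ 7 , + 7 , - + 8) , (- + 3 , - + 4 , + 4) , (- + 6 , - + 6 , + 7)
M⁻¹ (suc (suc zero)) = (+ 4 , + 3 , - + 4) , (+ 3 , + 4 , - + 4) , (- + 6 , - + 6 , + 7)
M⁻¹ (suc (suc (suc zero))) = (- + 4 , - + 3 , + 4) , (+ 7 , + 7 , - + 8) , (- + 6 , - + 6 , + 7)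
M⁻¹ (suc (suc (suc (suc zero)))) = (+ 3 , + 4 , - + 4) , (- + 7 , - + 7 , + 8) , (- + 6 , - + 6 , + 7)

M⁻¹-inverse : ∀ d → M⁻¹ d ⊗ M d ≡ I₃
M⁻¹-inverse zero = refl
M⁻¹-inverse (suc zero) = refl
M⁻¹-inverse (suc (suc zero)) = refl
M⁻¹-inverse (suc (suc (suc zero))) = refl
M⁻¹-inverse (suc (suc (suc (suc zero)))) = refl

_∣ᵛ_ : ℤ → V3 → Set
k ∣ᵛ (a , b , c) = (k ∣ a) × (k ∣ b) × (k ∣ c)

Primitive : V3 → Set
Primitive v = ∀ k → k ∣ᵛ v → k ∣ + 1

∣ᵛ-dot : ∀ r {k v} → k ∣ᵛ v → k ∣ dot r v
∣ᵛ-dot (a , b , c) (k∣x , k∣y , k∣z) =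
  ∣m∣n⇒∣m+n (∣m∣n⇒∣m+n (∣n⇒∣m*n a k∣x) (∣n⇒∣m*n b k∣y)) (∣n⇒∣m*n c k∣z)

∣ᵛ-· : ∀ m {k v} → k ∣ᵛ v → k ∣ᵛ (m · v)
∣ᵛ-· (r₁ , r₂ , r₃) k∣v = ∣ᵛ-dot r₁ k∣v , ∣ᵛ-dot r₂ k∣v , ∣ᵛ-dot r₃ k∣v

-- A matrix with an integer left inverse maps primitive vectors to primitive
-- vectors: a common divisor of m v divides n (m v) = v.
primitive-preserved : ∀ n m → n ⊗ m ≡ I₃ → ∀ {v} → Primitive v → Primitive (m · v)
primitive-preserved n m inverse {v} v-primitive k k∣mv =
  v-primitive k (subst (k ∣ᵛ_) n·m·v≡v (∣ᵛ-· n k∣mv))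
  where
  n·m·v≡v : n · (m · v) ≡ v
  n·m·v≡v = trans (·-assoc n m v) (trans (cong (_· v) inverse) (·-identity v))

word-primitive : ∀ ds {v} → Primitive v → Primitive (applyWord ds v)
word-primitive [] p = p
word-primitive (d ∷ ds) p = primitive-preserved (M⁻¹ d) (M d) (M⁻¹-inverse d) (word-primitive ds p)

-- u₂ and u₅ are primitive: 3·5 − 2·7 = 1.
u₂-primitive : Primitive u₂
u₂-primitive k (k∣5 , _ , k∣7) = ∣m∣n⇒∣m-n (∣n⇒∣m*n (+ 3) k∣5) (∣n⇒∣m*n (+ 2) k∣7)

u₅-primitive : Primitive u₅
u₅-primitive k (_ , k∣5 , k∣7) = ∣m∣n⇒∣m-n (∣n⇒∣m*n (+ 3) k∣5) (∣n⇒∣m*n (+ 2) k∣7)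

e₁ e₂ e₃ e₄ : V3
e₁ = + 1 , + 0 , + 1
e₂ = + 0 , + 1 , + 1
e₃ = + 3 , + 2 , + 4
e₄ = + 2 , + 3 , + 4

data Generator : V3 → Set where
  g₁ : Generator e₁
  g₂ : Generator e₂
  g₃ : Generator e₃
  g₄ : Generator e₄

data Cone : V3 → Set where
  generator : ∀ {v} → Generator v → Cone v
  sum : ∀ {u v} → Cone u → Cone v → Cone (u ⊕ v)
  scale : ∀ n {v} → Cone v → Cone (+ n ⊙ v)

combination : ∀ a b c d → Cone (+ a ⊙ e₁ ⊕ + b ⊙ e₂ ⊕ + c ⊙ e₃ ⊕ + d ⊙ e₄)
combination a b c d =
  sum (sum (sum (scale a (generator g₁)) (scale b (generator g₂))) (scale c (generator g₃)))
      (scale d (generator g₄))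

cone-preserved : ∀ m → (∀ {g} → Generator g → Cone (m · g)) → ∀ {v} → Cone v → Cone (m · v)
cone-preserved m on-generators (generator g) = on-generators g
cone-preserved m on-generators (sum {u} {v} cu cv) =
  subst Cone (sym (·-additive m u v)) (sum (cone-preserved m on-generators cu) (cone-preserved m on-generators cv))
cone-preserved m on-generators (scale n {v} cv) =
  subst Cone (sym (·-homogeneous m (+ n) v)) (scale n (cone-preserved m on-generators cv))

M-generator : ∀ d {g} → Generator g → Cone (M d · g)
M-generator zero g₁ = combination 1 0 0 0
M-generator zero g₂ = combination 2 1 1 0
M-generator zero g₃ = combination 6 0 1 0
M-generator zero g₄ = combination 7 1 2 0
M-generator (suc zero) g₁ = combination 2 3 2 0
M-generator (suc zero) g₂ = combination 2 1 1 0
M-generator (suc zero) g₃ = combination 9 9 7 0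
M-generator (suc zero) g₄ = combination 9 7 6 0
M-generator (suc (suc zero)) g₁ = combination 2 3 2 0
M-generator (suc (suc zero)) g₂ = combination 1 4 2 0
M-generator (suc (suc zero)) g₃ = combination 7 15 9 0
M-generator (suc (suc zero)) g₄ = combination 6 16 9 0
M-generator (suc (suc (suc zero))) g₁ = combination 0 3 1 0
M-generator (suc (suc (suc zero))) g₂ = combination 1 4 2 0
M-generator (suc (suc (suc zero))) g₃ = combination 1 15 6 0
M-generator (suc (suc (suc zero))) g₄ = combination 2 16 7 0
M-generator (suc (suc (suc (suc zero)))) g₁ = combination 0 3 1 0
M-generator (suc (suc (suc (suc zero)))) g₂ = combination 0 1 0 0
M-generator (suc (suc (suc (suc zero)))) g₃ = combination 0 8 1 1
M-generator (suc (suc (suc (suc zero)))) g₄ = combination 0 6 0 1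

word-cone : ∀ ds {v} → Cone v → Cone (applyWord ds v)
word-cone [] cv = cv
word-cone (d ∷ ds) cv = cone-preserved (M d) (M-generator d) (word-cone ds cv)

cone-third : ∀ {v} → Cone v → Σ ℕ (λ n → third v ≡ + n)
cone-third (generator g₁) = 1 , refl
cone-third (generator g₂) = 1 , refl
cone-third (generator g₃) = 4 , refl
cone-third (generator g₄) = 4 , refl
cone-third (sum cu cv) with cone-third cu | cone-third cv
... | m , u₃≡m | n , v₃≡n = m + n , trans (cong₂ _+ℤ_ u₃≡m v₃≡n) (sym (pos-+ m n))
cone-third (scale k cv) with cone-third cv
... | n , v₃≡n = k * n , trans (cong (+ k *ℤ_) v₃≡n) (sym (pos-* k n))

Ht≤∣third∣ : ∀ v → Ht v ≤ ∣ third v ∣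
Ht≤∣third∣ (a , b , c) with gcd (gcd ∣ a ∣ ∣ b ∣) ∣ c ∣
... | ℕ.zero = z≤n
... | ℕ.suc g = m/n≤m ∣ c ∣ (ℕ.suc g)

primitive-gcd : ∀ a b c → Primitive (a , b , c) → gcd (gcd ∣ a ∣ ∣ b ∣) ∣ c ∣ ≡ 1
primitive-gcd a b c p = ∣1⇒≡1 (∣⇒∣ᵤ (p (+ g) (∣ᵤ⇒∣ g∣a , ∣ᵤ⇒∣ g∣b , ∣ᵤ⇒∣ g∣c)))
  where
  g : ℕ
  g = gcd (gcd ∣ a ∣ ∣ b ∣) ∣ c ∣
  g∣a : g ∣ℕ ∣ a ∣
  g∣a = ∣-trans (gcd[m,n]∣m (gcd ∣ a ∣ ∣ b ∣) ∣ c ∣) (gcd[m,n]∣m ∣ a ∣ ∣ b ∣)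
  g∣b : g ∣ℕ ∣ b ∣
  g∣b = ∣-trans (gcd[m,n]∣m (gcd ∣ a ∣ ∣ b ∣) ∣ c ∣) (gcd[m,n]∣n ∣ a ∣ ∣ b ∣)
  g∣c : g ∣ℕ ∣ c ∣
  g∣c = gcd[m,n]∣n (gcd ∣ a ∣ ∣ b ∣) ∣ c ∣

Ht-primitive : ∀ v → Primitive v → Ht v ≡ ∣ third v ∣
Ht-primitive (a , b , c) p rewrite primitive-gcd a b c p = n/1≡n ∣ c ∣

word-third : ∀ ds k u w →
  third (applyWord ds (k ⊙ u ⊕ w)) ≡ k *ℤ third (applyWord ds u) +ℤ third (applyWord ds w)
word-third ds k u w = begin
  third (applyWord ds (k ⊙ u ⊕ w))                ≡⟨ cong third (word-additive ds (k ⊙ u) w) ⟩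
  third (applyWord ds (k ⊙ u) ⊕ applyWord ds w)   ≡⟨ cong (λ t → third (t ⊕ applyWord ds w)) (word-homogeneous ds k u) ⟩
  k *ℤ third (applyWord ds u) +ℤ third (applyWord ds w) ∎
  where open ≡-Reasoning

-- The height gap: if v = k u + w with u, w in the cone and v primitive, then
-- k Ht(W u) ≤ Ht(W v) for every word W, because (W v)₃ = k (W u)₃ + (W w)₃
-- with both summands nonnegative.
height-gap : ∀ ds k {u w} → Cone u → Cone w → Primitive (+ k ⊙ u ⊕ w) →
  k * Ht (applyWord ds u) ≤ Ht (applyWord ds (+ k ⊙ u ⊕ w))
height-gap ds k {u} {w} cu cw v-primitive
  with cone-third (word-cone ds cu) | cone-third (word-cone ds cw)
... | m , Wu₃≡m | n , Ww₃≡n = begin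
  k * Ht (applyWord ds u)    ≤⟨ *-monoʳ-≤ k (≤-trans (Ht≤∣third∣ (applyWord ds u)) (≤-reflexive (cong ∣_∣ Wu₃≡m))) ⟩
  k * m                      ≤⟨ m≤m+n (k * m) n ⟩
  k * m + n                  ≡⟨ cong ∣_∣ (sym Wv₃≡km+n) ⟩
  ∣ third (applyWord ds v) ∣ ≡⟨ sym (Ht-primitive (applyWord ds v) (word-primitive ds v-primitive)) ⟩
  Ht (applyWord ds v)        ∎
  where
  open ≤-Reasoning
  v : V3
  v = + k ⊙ u ⊕ w
  Wv₃≡km+n : third (applyWord ds v) ≡ + (k * m + n)
  Wv₃≡km+n = trans (word-third ds (+ k) u w) (trans (cong₂ (λ s t → + k *ℤ s +ℤ t) Wu₃≡m Ww₃≡n)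
               (trans (cong (_+ℤ + n) (sym (pos-* k m))) (sym (pos-+ (k * m) n))))

-- u₂ = 3 u₁ + e₄ and u₅ = 3 u₆ + e₃, with u₁ = e₁ and u₆ = e₂.
proposition2p14 : (ds : List (Fin 5)) →
    (3 * Ht (y ds u₁) ≤ Ht (y ds u₂)) × (3 * Ht (y ds u₆) ≤ Ht (y ds u₅))
proposition2p14 ds =
  height-gap ds 3 (generator g₁) (generator g₄) u₂-primitive ,
  height-gap ds 3 (generator g₂) (generator g₃) u₅-primitive
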